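{- For all $G,G'\subseteq F^n_{Ev}$, $\Omega(G)=\Omega(G')$ holds if and only if $\Theta(G)=\Theta(G')$.
   Context: $F^n$ is the set of binary words of length $n$ with Hamming distance $d$; $F^n_{Ev}$ the even-weight words. $\Omega(\bar x)=\{\bar y\in F^n:d(\bar y,\bar x)=1\}$, $\Omega(S)=\bigcup_{\bar x\in S}\Omega(\bar x)$, and for $G\subseteq F^n_{Ev}$, $\Theta(G)=\{\bar x\in F^n_{Ev}:\Omega(\bar x)\subseteq\Omega(G)\}$. -}

module Defs where

open import Data.Bool using (Bool; true; false; _xor_)
open import Data.Nat using (ℕ; zero; suc; _+_; _%_)
open import Data.Vec using (Vec; []; _∷_; count)
open import Data.Product using (Σ; _×_; _,_)
open import Relation.Binary.PropositionalEquality using (_≡_)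
open import Level using (0ℓ)
open import Relation.Unary using (Pred; _⊆_; _≐_)

Word : ℕ → Set
Word n = Vec Bool n

weight : ∀ {n} → Word n → ℕ
weight [] = 0
weight (true ∷ xs) = suc (weight xs)
weight (false ∷ xs) = weight xs

hamming : ∀ {n} → Word n → Word n → ℕ
hamming [] [] = 0
hamming (a ∷ xs) (b ∷ ys) with a xor b
... | true = suc (hamming xs ys)
... | false = hamming xs ys

Even : ∀ {n} → Word n → Set
Even x = weight x % 2 ≡ 0

WSet : ℕ → Set₁
WSet n = Pred (Word n) 0ℓ

Ωpt : ∀ {n} → Word n → WSet n
Ωpt x y = hamming y x ≡ 1

Ω : ∀ {n} → WSet n → WSet n
Ω S y = Σ (Word _) λ x → S x × Ωpt x y

Θ : ∀ {n} → WSet n → WSet n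
Θ G x = Even x × (Ωpt x ⊆ Ω G)

{-# OPTIONS --safe #-}
-- Θ G depends on G only through Ω G, which gives one direction. Conversely,
-- an even G lies inside Θ G, while Ω (Θ G) ⊆ Ω G for every G; hence
-- Ω G = Ω (Θ G), so Ω G is determined by Θ G.
module Submission where

open import Defs
open import Data.Nat using (ℕ)
open import Data.Product using (_,_; proj₂)
open import Relation.Unary using (_⊆_; _≐_)
open import Relation.Unary.Properties using (≐-sym; ≐-trans)
open import Function.Bundles using (_⇔_; mk⇔)

-- Ω S y does not determine y (hamming is not injective), so inclusions
-- between Ω-sets are passed on eta-expanded, as λ {y} → … {y}.
module _ {n : ℕ} where

  Ω-mono : {S T : WSet n} → S ⊆ T → Ω S ⊆ Ω T
  Ω-mono S⊆T (x , x∈S , y∈Ωx) = x , S⊆T x∈S , y∈Ωx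

  Ω-cong : {S T : WSet n} → S ≐ T → Ω S ≐ Ω T
  Ω-cong (S⊆T , T⊆S) = (λ {y} → Ω-mono S⊆T {y}) , (λ {y} → Ω-mono T⊆S {y})

  Ω-Θ⊆Ω : (G : WSet n) → Ω (Θ G) ⊆ Ω G
  Ω-Θ⊆Ω G {y} (x , x∈ΘG , y∈Ωx) = proj₂ x∈ΘG {y} y∈Ωx

  even⇒⊆Θ : (G : WSet n) → G ⊆ Even → G ⊆ Θ G
  even⇒⊆Θ G G⊆Even {x} x∈G = G⊆Even x∈G , λ y∈Ωx → x , x∈G , y∈Ωx

  Ω-Θ≐Ω : (G : WSet n) → G ⊆ Even → Ω (Θ G) ≐ Ω G
  Ω-Θ≐Ω G G⊆Even =
    (λ {y} → Ω-Θ⊆Ω G {y}) , (λ {y} → Ω-mono (even⇒⊆Θ G G⊆Even) {y})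

  Ω⊆⇒Θ⊆ : {G G′ : WSet n} → Ω G ⊆ Ω G′ → Θ G ⊆ Θ G′
  Ω⊆⇒Θ⊆ ΩG⊆ΩG′ (x-even , Ωx⊆ΩG) =
    x-even , λ {y} y∈Ωx → ΩG⊆ΩG′ {y} (Ωx⊆ΩG {y} y∈Ωx)

  Ω≐⇒Θ≐ : {G G′ : WSet n} → Ω G ≐ Ω G′ → Θ G ≐ Θ G′
  Ω≐⇒Θ≐ (ΩG⊆ΩG′ , ΩG′⊆ΩG) =
    Ω⊆⇒Θ⊆ (λ {y} → ΩG⊆ΩG′ {y}) , Ω⊆⇒Θ⊆ (λ {y} → ΩG′⊆ΩG {y})

  Θ≐⇒Ω≐ : {G G′ : WSet n} → G ⊆ Even → G′ ⊆ Even → Θ G ≐ Θ G′ → Ω G ≐ Ω G′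
  Θ≐⇒Ω≐ {G} {G′} G⊆Even G′⊆Even ΘG≐ΘG′ =
    ≐-trans (≐-sym (Ω-Θ≐Ω G G⊆Even)) (≐-trans (Ω-cong ΘG≐ΘG′) (Ω-Θ≐Ω G′ G′⊆Even))

proposition4 : (n : ℕ) (G G′ : WSet n) → G ⊆ Even → G′ ⊆ Even →
    (Ω G ≐ Ω G′) ⇔ (Θ G ≐ Θ G′)
proposition4 n G G′ G⊆Even G′⊆Even = mk⇔ Ω≐⇒Θ≐ (Θ≐⇒Ω≐ G⊆Even G′⊆Even)
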